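{- Let $\mathbb{M}=(M,+,0)$ be a commutative monoid, $A$ a finite set, and $FX=(\mathcal{F}_{\mathbb{M}}X)^A$ on $\mathsf{Set}$ (weighted transition systems), with final coalgebra $(\nu F,t)$ and rational fixpoint $\rho F\subseteq\nu F$. Let $\Sigma$ be a signature with finitely many operation symbols of finite arity and $\lambda:\Sigma(F\times\mathrm{Id})\Rightarrow F(\Sigma+\mathrm{Id})$ a natural transformation, i.e. with components $\lambda_X:\Sigma((\mathcal{F}_{\mathbb{M}}X)^A\times X)\to(\mathcal{F}_{\mathbb{M}}(\Sigma X+X))^A$ (for instance one induced by a bipointed WTS SOS specification). Let $\alpha:\Sigma(\nu F)\to\nu F$ be the unique map with $t\circ\alpha=F[\alpha,\mathrm{id}]\circ\lambda_{\nu F}\circ\Sigma\langle t,\mathrm{id}\rangle$. Then $\rho F$ is closed under all operations of $\alpha$.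
   Context: $\mathcal{F}_{\mathbb{M}}X=\{\phi:X\to M\mid \phi(x)\neq0\text{ for only finitely many }x\}$ and $\mathcal{F}_{\mathbb{M}}f(\phi)(y)=\sum_{x\in f^{ -1}(y)}\phi(x)$. A signature is identified with the polynomial functor $\Sigma X=\coprod_fX^{|f|}$. The rational fixpoint $\rho F$ is the subset of $\nu F$ consisting of the images of all finite $F$-coalgebras under their unique homomorphisms into $\nu F$ (finite weighted transition systems modulo weighted bisimilarity). -}

module Defs where

open import Level using (0ℓ)
open import Algebra.Bundles using (CommutativeMonoid)
open import Data.Nat using (ℕ)
open import Data.Fin using (Fin)
open import Data.List using (List; []; _∷_) renaming (map to lmap)
open import Data.Product using (Σ; _×_; _,_; ∃; ∃-syntax; <_,_>) renaming (map to pmap)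
open import Data.Sum using (_⊎_; inj₁; inj₂; [_,_]) renaming (map to smap)
open import Data.Vec using (Vec) renaming (map to vmap)
open import Data.Vec.Relation.Binary.Pointwise.Inductive using (Pointwise)
open import Data.Vec.Relation.Unary.All using (All)
open import Function using (id)
open import Relation.Binary.PropositionalEquality using (_≡_)

record Signature : Set where
  field
    nOps  : ℕ
    arity : Fin nOps → ℕ

module Setup (𝕄 : CommutativeMonoid 0ℓ 0ℓ) (a : ℕ) (S : Signature) where
  open CommutativeMonoid 𝕄 renaming (Carrier to M)
  open Signature S

  -- An element of F_𝕄 X is presented by a finite list of weighted
  -- elements [(x₁,m₁),…,(xₖ,mₖ)], denoting φ = Σᵢ mᵢ·δ_{xᵢ}; two lists
  -- denote the same finitely supported function iff they are related by
  -- _∼_ (the standard presentation of ⊕_{x∈X} M).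
  FM : Set → Set
  FM X = List (X × M)

  data _∼_ {X : Set} : FM X → FM X → Set where
    ∼-refl  : ∀ {φ} → φ ∼ φ
    ∼-sym   : ∀ {φ ψ} → φ ∼ ψ → ψ ∼ φ
    ∼-trans : ∀ {φ ψ χ} → φ ∼ ψ → ψ ∼ χ → φ ∼ χ
    ∼-cons  : ∀ {x m m′ φ ψ} → m ≈ m′ → φ ∼ ψ → ((x , m) ∷ φ) ∼ ((x , m′) ∷ ψ)
    ∼-swap  : ∀ {p q φ} → (p ∷ q ∷ φ) ∼ (q ∷ p ∷ φ)
    ∼-merge : ∀ {x m n φ} → ((x , m) ∷ (x , n) ∷ φ) ∼ ((x , m ∙ n) ∷ φ)
    ∼-zero  : ∀ {x φ} → ((x , ε) ∷ φ) ∼ φ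

  FMmap : ∀ {X Y : Set} → (X → Y) → FM X → FM Y
  FMmap f = lmap (pmap f id)

  F : Set → Set
  F X = Fin a → FM X

  _≈F_ : ∀ {X : Set} → F X → F X → Set
  φ ≈F ψ = ∀ i → φ i ∼ ψ i

  Fmap : ∀ {X Y : Set} → (X → Y) → F X → F Y
  Fmap f φ i = FMmap f (φ i)

  IsHom : ∀ {C D : Set} → (C → F C) → (D → F D) → (C → D) → Set
  IsHom c d h = ∀ x → Fmap h (c x) ≈F d (h x)

  record IsFinal (Z : Set) (t : Z → F Z) : Set₁ where
    field
      unfold     : (C : Set) → (C → F C) → C → Z
      unfold-hom : (C : Set) (c : C → F C) → IsHom c t (unfold C c)
      unique     : (C : Set) (c : C → F C) (h : C → Z) → IsHom c t h →
                   ∀ x → h x ≡ unfold C c x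

  -- Rational fixpoint ρF ⊆ νF: images of states of finite coalgebras
  -- (carrier Fin n) under their unique homomorphism into νF.
  InRho : ∀ {Z : Set} {t : Z → F Z} → IsFinal Z t → Z → Set
  InRho fin r = ∃[ n ] ∃[ c ] ∃[ x ] (IsFinal.unfold fin (Fin n) c x ≡ r)

  ΣF : Set → Set
  ΣF X = Σ (Fin nOps) (λ f → Vec X (arity f))

  Σmap : ∀ {X Y : Set} → (X → Y) → ΣF X → ΣF Y
  Σmap g (f , v) = f , vmap g v

  data ΣRel {X : Set} (R : X → X → Set) : ΣF X → ΣF X → Set where
    same-op : ∀ {f v w} → Pointwise R v w → ΣRel R (f , v) (f , w)

  PairRel : ∀ {X : Set} → F X × X → F X × X → Set
  PairRel (φ , x) (ψ , y) = (φ ≈F ψ) × (x ≡ y)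

  record NatTrans : Set₁ where
    field
      law     : (X : Set) → ΣF (F X × X) → F (ΣF X ⊎ X)
      -- well-defined on the presented sets
      law-resp : (X : Set) {s s′ : ΣF (F X × X)} → ΣRel PairRel s s′ →
                 law X s ≈F law X s′
      natural : ∀ {X Y : Set} (g : X → Y) (s : ΣF (F X × X)) →
                Fmap (smap (Σmap g) g) (law X s)
                  ≈F law Y (Σmap (pmap (Fmap g) g) s)

  IsInducedAlg : (Λ : NatTrans) (Z : Set) (t : Z → F Z) → (ΣF Z → Z) → Set
  IsInducedAlg Λ Z t α =
    ∀ s → t (α s) ≈F Fmap [ α , id ] (NatTrans.law Λ Z (Σmap < t , id > s))

module Submission where

-- Call z ∈ νF
-- rational if it is the image of a state of a finite coalgebra.
--   (1) Every state of ANY finite coalgebra is rational: a finite C is a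
--       retract of some Fin n, and C's structure transports along the
--       retraction so that the enumeration Fin n → C is a homomorphism.
--   (2) Finitely many rational elements z₁ … zₖ all come from ONE finite
--       coalgebra (C , c): take the coproduct of their witnesses.
--   (3) Given (C , c) with unfolding u : C → νF, the "one-step extension"
--       coalgebra on ΣC + C, with structure λ_C ∘ Σ⟨c,id⟩ on ΣC and c on C,
--       is finite, and [α ∘ Σu , u] is a homomorphism into νF (this is
--       where naturality of λ and the defining equation of α are used).
-- For f(z₁,…,zₖ) pick (C , c, x₁ … xₖ) by (2); by finality and (3) the
-- state inj₁ (f , x⃗) of the extension unfolds to α (f , z⃗), which is
-- rational by (1).

open import Defs
open import Level using (0ℓ)
open import Algebra.Bundles using (CommutativeMonoid)
open import Data.Nat using (ℕ; zero; suc; _+_; _*_)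
open import Data.Fin using (Fin; splitAt; join; remQuot; combine) renaming (zero to fzero; suc to fsuc)
open import Data.Fin.Properties using (splitAt-join; remQuot-combine)
open import Data.Product using (Σ; _×_; _,_; <_,_>) renaming (map to pmap)
open import Data.Sum using (_⊎_; inj₁; inj₂; [_,_]) renaming (map to smap)
import Data.List.Properties as List
open import Data.Vec using (Vec; []; _∷_) renaming (map to vmap)
open import Data.Vec.Relation.Binary.Pointwise.Inductive as Pointwise using (Pointwise)
open import Data.Vec.Relation.Unary.All using (All; []; _∷_)
open import Function using (id; _∘_)
open import Relation.Binary.Bundles using (Setoid)
import Relation.Binary.Reasoning.Setoid as SetoidReasoning
open import Relation.Binary.PropositionalEquality using (_≡_; refl; sym; trans; cong; cong₂; subst)

-- A set is finite when it is a retract of some Fin n: an enumeration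
-- Fin size → C with a section.  (No injectivity is needed anywhere.)
record Finite (C : Set) : Set where
  field
    size       : ℕ
    enum       : Fin size → C
    index      : C → Fin size
    enum-index : ∀ x → enum (index x) ≡ x

open Finite

finite-retract : ∀ {A B : Set} → Finite A → (g : A → B) (h : B → A) →
                 (∀ y → g (h y) ≡ y) → Finite B
finite-retract fA g h gh = record
  { size = size fA ; enum = g ∘ enum fA ; index = index fA ∘ h
  ; enum-index = λ y → trans (cong g (enum-index fA (h y))) (gh y) }

finite-Fin : ∀ n → Finite (Fin n)
finite-Fin n = record { size = n ; enum = id ; index = id ; enum-index = λ _ → refl }

finite-⊎ : ∀ {A B : Set} → Finite A → Finite B → Finite (A ⊎ B)
finite-⊎ fA fB = record
  { size = size fA + size fB
  ; enum = smap (enum fA) (enum fB) ∘ splitAt (size fA)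
  ; index = join (size fA) (size fB) ∘ smap (index fA) (index fB)
  ; enum-index = λ x → trans (cong (smap (enum fA) (enum fB))
                               (splitAt-join (size fA) (size fB) (smap (index fA) (index fB) x)))
                             (enum-index-⊎ x) }
  where
  enum-index-⊎ : ∀ x → smap (enum fA) (enum fB) (smap (index fA) (index fB) x) ≡ x
  enum-index-⊎ (inj₁ x) = cong inj₁ (enum-index fA x)
  enum-index-⊎ (inj₂ y) = cong inj₂ (enum-index fB y)

finite-× : ∀ {A B : Set} → Finite A → Finite B → Finite (A × B)
finite-× fA fB = record
  { size = size fA * size fB
  ; enum = pmap (enum fA) (enum fB) ∘ remQuot (size fB)
  ; index = λ (x , y) → combine (index fA x) (index fB y)
  ; enum-index = λ (x , y) →
      trans (cong (pmap (enum fA) (enum fB)) (remQuot-combine (index fA x) (index fB y)))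
            (cong₂ _,_ (enum-index fA x) (enum-index fB y)) }

finite-Vec : ∀ {A : Set} → Finite A → ∀ k → Finite (Vec A k)
finite-Vec fA zero = finite-retract (finite-Fin 1) (λ _ → []) (λ _ → fzero) (λ { [] → refl })
finite-Vec fA (suc k) =
  finite-retract (finite-× fA (finite-Vec fA k)) (λ (x , xs) → x ∷ xs)
    (λ { (x ∷ xs) → x , xs }) (λ { (x ∷ xs) → refl })

finite-ΣFin : ∀ m (P : Fin m → Set) → (∀ i → Finite (P i)) → Finite (Σ (Fin m) P)
finite-ΣFin zero P fP = finite-retract (finite-Fin 0) (λ ()) (λ { (() , _) }) (λ { (() , _) })
finite-ΣFin (suc m) P fP =
  finite-retract (finite-⊎ (fP fzero) (finite-ΣFin m (P ∘ fsuc) (fP ∘ fsuc)))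
    [ (λ p → fzero , p) , (λ (i , p) → fsuc i , p) ]
    (λ { (fzero , p) → inj₁ p ; (fsuc i , p) → inj₂ (i , p) })
    (λ { (fzero , p) → refl ; (fsuc i , p) → refl })

module _ (𝕄 : CommutativeMonoid 0ℓ 0ℓ) (a : ℕ) (S : Signature) where
  open Setup 𝕄 a S
  open Signature S

  finite-ΣF : ∀ {C : Set} → Finite C → Finite (ΣF C)
  finite-ΣF {C} fC = finite-ΣFin nOps (λ f → Vec C (arity f)) (λ f → finite-Vec fC (arity f))

  F-setoid : Set → Setoid 0ℓ 0ℓ
  F-setoid X = record
    { Carrier = F X ; _≈_ = _≈F_
    ; isEquivalence = record
      { refl = λ _ → ∼-refl ; sym = λ p i → ∼-sym (p i) ; trans = λ p q i → ∼-trans (p i) (q i) } }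

  ≈F-sym : ∀ {X : Set} {φ ψ : F X} → φ ≈F ψ → ψ ≈F φ
  ≈F-sym = Setoid.sym (F-setoid _)

  ≈F-trans : ∀ {X : Set} {φ ψ χ : F X} → φ ≈F ψ → ψ ≈F χ → φ ≈F χ
  ≈F-trans = Setoid.trans (F-setoid _)

  FMmap-resp : ∀ {X Y : Set} (g : X → Y) {φ ψ : FM X} → φ ∼ ψ → FMmap g φ ∼ FMmap g ψ
  FMmap-resp g ∼-refl        = ∼-refl
  FMmap-resp g (∼-sym p)     = ∼-sym (FMmap-resp g p)
  FMmap-resp g (∼-trans p q) = ∼-trans (FMmap-resp g p) (FMmap-resp g q)
  FMmap-resp g (∼-cons e p)  = ∼-cons e (FMmap-resp g p)
  FMmap-resp g ∼-swap        = ∼-swap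
  FMmap-resp g ∼-merge       = ∼-merge
  FMmap-resp g ∼-zero        = ∼-zero

  Fmap-resp : ∀ {X Y : Set} (g : X → Y) {φ ψ : F X} → φ ≈F ψ → Fmap g φ ≈F Fmap g ψ
  Fmap-resp g p i = FMmap-resp g (p i)

  ≡⇒∼ : ∀ {X : Set} {φ ψ : FM X} → φ ≡ ψ → φ ∼ ψ
  ≡⇒∼ refl = ∼-refl

  Fmap-id : ∀ {X : Set} (φ : F X) → Fmap id φ ≈F φ
  Fmap-id φ i = ≡⇒∼ (List.map-id (φ i))

  Fmap-∘ : ∀ {X Y W : Set} (g : Y → W) (h : X → Y) (φ : F X) →
           Fmap (g ∘ h) φ ≈F Fmap g (Fmap h φ)
  Fmap-∘ g h φ i = ≡⇒∼ (List.map-∘ (φ i))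

  Fmap-cong : ∀ {X Y : Set} {g h : X → Y} → (∀ x → g x ≡ h x) → (φ : F X) →
              Fmap g φ ≈F Fmap h φ
  Fmap-cong g≗h φ i = ≡⇒∼ (List.map-cong (λ (x , m) → cong (_, m) (g≗h x)) (φ i))

  hom-∘ : ∀ {C D E : Set} {c : C → F C} {d : D → F D} {e : E → F E} {h : C → D} {g : D → E} →
          IsHom c d h → IsHom d e g → IsHom c e (g ∘ h)
  hom-∘ {c = c} {h = h} {g = g} hom-h hom-g x =
    ≈F-trans (Fmap-∘ g h (c x)) (≈F-trans (Fmap-resp g (hom-h x)) (hom-g (h x)))

  -- The coproduct of two coalgebras; its injections are homomorphisms
  -- on the nose (the obligation is ∼-refl).
  _⊕_ : ∀ {C D : Set} → (C → F C) → (D → F D) → (C ⊎ D → F (C ⊎ D))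
  (c ⊕ d) (inj₁ x) = Fmap inj₁ (c x)
  (c ⊕ d) (inj₂ y) = Fmap inj₂ (d y)

  module _ (Z : Set) (t : Z → F Z) (fin : IsFinal Z t) where
    open IsFinal fin

    unfold-∘-hom : ∀ {C D : Set} {c : C → F C} {d : D → F D} (h : C → D) → IsHom c d h →
                   ∀ x → unfold D d (h x) ≡ unfold C c x
    unfold-∘-hom {C} {D} {c} {d} h hom-h = unique C c (unfold D d ∘ h) (hom-∘ {e = t} hom-h (unfold-hom D d))

    rational-of-finite : ∀ {C : Set} → Finite C → (c : C → F C) → ∀ x → InRho fin (unfold C c x)
    rational-of-finite {C} fC c x = size fC , c′ , index fC x , unfold-c′
      where
      c′ : Fin (size fC) → F (Fin (size fC))
      c′ i = Fmap (index fC) (c (enum fC i))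

      enum-hom : IsHom c′ c (enum fC)
      enum-hom i = ≈F-trans (≈F-sym (Fmap-∘ (enum fC) (index fC) (c (enum fC i))))
                            (≈F-trans (Fmap-cong (enum-index fC) (c (enum fC i))) (Fmap-id (c (enum fC i))))

      unfold-c′ : unfold (Fin (size fC)) c′ (index fC x) ≡ unfold C c x
      unfold-c′ = trans (sym (unfold-∘-hom (enum fC) enum-hom (index fC x)))
                        (cong (unfold C c) (enum-index fC x))

    record CommonWitness {k : ℕ} (zs : Vec Z k) : Set₁ where
      field
        Carrier  : Set
        finite   : Finite Carrier
        coalg    : Carrier → F Carrier
        states   : Vec Carrier k
        unfolds  : vmap (unfold Carrier coalg) states ≡ zs

    common-witness : ∀ {k} (zs : Vec Z k) → All (InRho fin) zs → CommonWitness zs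
    common-witness [] [] = record
      { Carrier = Fin 0 ; finite = finite-Fin 0 ; coalg = λ () ; states = [] ; unfolds = refl }
    common-witness (z ∷ zs) ((n , c , x , unfold-x) ∷ rational-zs) = record
      { Carrier = Fin n ⊎ C
      ; finite  = finite-⊎ (finite-Fin n) finite
      ; coalg   = c ⊕ coalg
      ; states  = inj₁ x ∷ vmap inj₂ states
      ; unfolds = cong₂ _∷_ (trans (unfold-∘-hom inj₁ (λ _ _ → ∼-refl) x) unfold-x)
                            (trans (unfold-inj₂ states) unfolds) }
      where
      open CommonWitness (common-witness zs rational-zs) renaming (Carrier to C)

      unfold-inj₂ : ∀ {j} (ys : Vec C j) →
                    vmap (unfold (Fin n ⊎ C) (c ⊕ coalg)) (vmap inj₂ ys) ≡ vmap (unfold C coalg) ys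
      unfold-inj₂ []       = refl
      unfold-inj₂ (y ∷ ys) = cong₂ _∷_ (unfold-∘-hom inj₂ (λ _ _ → ∼-refl) y) (unfold-inj₂ ys)

    module _ (Λ : NatTrans) (α : ΣF Z → Z) (α-induced : IsInducedAlg Λ Z t α) where
      open NatTrans Λ

      extension : ∀ {C : Set} → (C → F C) → ΣF C ⊎ C → F (ΣF C ⊎ C)
      extension c (inj₁ s) = law _ (Σmap < c , id > s)
      extension c (inj₂ x) = Fmap inj₂ (c x)

      Σ-pair-hom : ∀ {C : Set} (c : C → F C) (s : ΣF C) →
                   ΣRel PairRel (Σmap (pmap (Fmap (unfold C c)) (unfold C c)) (Σmap < c , id > s))
                                (Σmap < t , id > (Σmap (unfold C c) s))
      Σ-pair-hom {C} c (f , xs) = same-op (Pointwise.map⁺ id pairs)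
        where
        u : C → Z
        u = unfold C c

        pairs : Pointwise (λ p y → PairRel (pmap (Fmap u) u p) (t y , y)) (vmap < c , id > xs) (vmap u xs)
        pairs = Pointwise.map⁺ (λ { refl → unfold-hom C c _ , refl }) (Pointwise.refl {_∼_ = _≡_} refl)

      extension-hom : ∀ {C : Set} (c : C → F C) →
                      IsHom (extension c) t [ α ∘ Σmap (unfold C c) , unfold C c ]
      extension-hom {C} c (inj₂ x) =
        ≈F-trans (≈F-sym (Fmap-∘ [ α ∘ Σmap (unfold C c) , unfold C c ] inj₂ (c x))) (unfold-hom C c x)
      extension-hom {C} c (inj₁ s) = begin
        Fmap [ α ∘ Σmap u , u ] (law C (Σmap < c , id > s))
          ≈⟨ Fmap-cong (λ { (inj₁ _) → refl ; (inj₂ _) → refl }) _ ⟩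
        Fmap ([ α , id ] ∘ smap (Σmap u) u) (law C (Σmap < c , id > s))
          ≈⟨ Fmap-∘ [ α , id ] (smap (Σmap u) u) _ ⟩
        Fmap [ α , id ] (Fmap (smap (Σmap u) u) (law C (Σmap < c , id > s)))
          ≈⟨ Fmap-resp [ α , id ] (natural u (Σmap < c , id > s)) ⟩
        Fmap [ α , id ] (law Z (Σmap (pmap (Fmap u) u) (Σmap < c , id > s)))
          ≈⟨ Fmap-resp [ α , id ] (law-resp Z (Σ-pair-hom c s)) ⟩
        Fmap [ α , id ] (law Z (Σmap < t , id > (Σmap u s)))
          ≈⟨ α-induced (Σmap u s) ⟨
        t (α (Σmap u s)) ∎
        where
        u : C → Z
        u = unfold C c
        open SetoidReasoning (F-setoid Z)

      rational-closed : ∀ f (zs : Vec Z (arity f)) → All (InRho fin) zs → InRho fin (α (f , zs))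
      rational-closed f zs rational-zs = subst (InRho fin) unfold-term rational-term
        where
        open CommonWitness (common-witness zs rational-zs) renaming (Carrier to C)

        D : Set
        D = ΣF C ⊎ C

        rational-term : InRho fin (unfold D (extension coalg) (inj₁ (f , states)))
        rational-term = rational-of-finite (finite-⊎ (finite-ΣF finite) finite) (extension coalg) _

        unfold-term : unfold D (extension coalg) (inj₁ (f , states)) ≡ α (f , zs)
        unfold-term = trans (sym (unique D (extension coalg) _ (extension-hom coalg) (inj₁ (f , states))))
                            (cong (λ ws → α (f , ws)) unfolds)

corollary5p7 : (𝕄 : CommutativeMonoid 0ℓ 0ℓ) (a : ℕ) (S : Signature) →
    let open Setup 𝕄 a S in
    let open Signature S in
    (Λ : NatTrans) (Z : Set) (t : Z → F Z) (fin : IsFinal Z t)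
    (α : ΣF Z → Z) → IsInducedAlg Λ Z t α →
    ∀ f (v : Vec Z (arity f)) → All (InRho fin) v → InRho fin (α (f , v))
corollary5p7 𝕄 a S Λ Z t fin = rational-closed 𝕄 a S Z t fin Λ
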